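{- Let $n\geq 1$ be an integer and let $\alpha\in\mathbb{Z}[X_n]\setminus\mathbb{Z}[X_{n-1}]$. Let $X^2+bX+c\in\mathbb{Z}[X_{n-1}][X]$ be the minimal polynomial of $\alpha$ over $\mathbb{Q}(X_{n-1})$. If $A=\begin{pmatrix} s & t\\ u & v\end{pmatrix}\in GL_2(\mathbb{Z}[X_{n-1}])$ satisfies $A\alpha=\alpha$, where $A$ acts by the Möbius transformation $A z=\frac{sz+t}{uz+v}$, then there exist $x,y\in\mathbb{Z}[X_{n-1}]$ such that $$A=\begin{pmatrix}\frac{x-by}{2} & -cy\\ y & \frac{x+by}{2}\end{pmatrix}.$$
   Context: For $m\geq 0$ let $X_m=2\cos(2\pi/2^{m+2})$ (so $X_0=0$, $X_1=\sqrt2$, $X_{m}=\sqrt{2+X_{m-1}}$), viewed as real numbers. The field $\mathbb{Q}(X_m)$ is the $m$-th layer of the cyclotomic $\mathbb{Z}_2$-extension of $\mathbb{Q}$ and its ring of integers is $\mathbb{Z}[X_m]$; $[\mathbb{Q}(X_n):\mathbb{Q}(X_{n-1})]=2$. -}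

module Defs where

open import Data.Nat using (ℕ; zero; suc)
open import Data.Integer as ℤ using (ℤ)
open import Data.Product using (_×_; _,_; Σ; ∃)
open import Relation.Binary.PropositionalEquality using (_≡_)
open import Relation.Nullary using (¬_)

-- ZX m represents the ring Z[X_m], X_m = 2cos(2π/2^(m+2)).
-- ZX 0 = ℤ  (X_0 = 0), and ZX (suc m) = ZX m × ZX m, where (a , b) stands for
-- a + b·X_{m+1}; indeed Z[X_{m+1}] = Z[X_m][X_{m+1}] is free over Z[X_m] with basis
-- 1, X_{m+1}, and X_{m+1}^2 = 2 + X_m.  The representation is unique, so ≡ is
-- equality in the ring.
ZX : ℕ → Set
ZX zero    = ℤ
ZX (suc m) = ZX m × ZX m

zeroX : ∀ m → ZX m
zeroX zero    = ℤ.0ℤ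
zeroX (suc m) = zeroX m , zeroX m

oneX : ∀ m → ZX m
oneX zero    = ℤ.1ℤ
oneX (suc m) = oneX m , zeroX m

addX : ∀ m → ZX m → ZX m → ZX m
addX zero    a b = a ℤ.+ b
addX (suc m) (a , b) (c , d) = addX m a c , addX m b d

negX : ∀ m → ZX m → ZX m
negX zero    a = ℤ.- a
negX (suc m) (a , b) = negX m a , negX m b

subX : ∀ m → ZX m → ZX m → ZX m
subX m a b = addX m a (negX m b)

genX : ∀ m → ZX m
genX zero    = ℤ.0ℤ
genX (suc m) = zeroX m , oneX m

mulX : ∀ m → ZX m → ZX m → ZX m
mulX zero    a b = a ℤ.* b
mulX (suc m) (a , b) (c , d) =
  addX m (mulX m a c) (mulX m (mulX m b d) (addX m (addX m (oneX m) (oneX m)) (genX m))) ,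
  addX m (mulX m a d) (mulX m b c)

twoX : ∀ m → ZX m
twoX m = addX m (oneX m) (oneX m)

incl : ∀ m → ZX m → ZX (suc m)
incl m a = a , zeroX m

-- X^2 + b X + c ∈ Z[X_m][X] is the minimal polynomial of α ∈ Z[X_{m+1}] over Q(X_m):
-- it is monic, α is a root, and no nonzero polynomial of degree ≤ 1 over Q(X_m)
-- has α as a root (after clearing denominators: over Z[X_m]).
IsMinPoly : ∀ m → ZX (suc m) → ZX m → ZX m → Set
IsMinPoly m α b c =
  addX (suc m) (addX (suc m) (mulX (suc m) α α) (mulX (suc m) (incl m b) α)) (incl m c)
    ≡ zeroX (suc m)
  × (∀ p q → addX (suc m) (mulX (suc m) (incl m p) α) (incl m q) ≡ zeroX (suc m)
       → (p ≡ zeroX m × q ≡ zeroX m))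

record Mat2 (m : ℕ) : Set where
  constructor mat
  field
    s t u v : ZX m

IsGL2 : ∀ m → Mat2 m → Set
IsGL2 m (mat s t u v) =
  Σ (ZX m) λ w → mulX m (subX m (mulX m s v) (mulX m t u)) w ≡ oneX m

-- A α = α for the Möbius action A z = (s z + t)/(u z + v):
-- the denominator u α + v is nonzero and s α + t = α (u α + v).
FixesMob : ∀ m → Mat2 m → ZX (suc m) → Set
FixesMob m (mat s t u v) α =
  ¬ (addX (suc m) (mulX (suc m) (incl m u) α) (incl m v) ≡ zeroX (suc m))
  × addX (suc m) (mulX (suc m) (incl m s) α) (incl m t)
      ≡ mulX (suc m) α (addX (suc m) (mulX (suc m) (incl m u) α) (incl m v))

{-# OPTIONS --safe #-}
module Submission where

-- Clearing the denominator, Aα = α says uα² + (v − s)α − t = 0. Subtracting u times the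
-- minimal polynomial leaves the relation (v − s − ub)α − (uc + t) = 0 with coefficients in
-- Z[X_{n-1}], so minimality forces v = s + ub and t = −cu, and x = s + v, y = u do the job.
-- The ring laws of Z[X_m] used on the way come from reading Z[X_{m+1}] as the quadratic
-- extension Z[X_m][√(2 + X_m)].

open import Defs
open import Data.Nat using (ℕ; zero; suc)
open import Data.Product using (_×_; _,_; Σ)
open import Relation.Binary.PropositionalEquality using (_≡_; refl; cong; cong₂; isEquivalence)
open import Relation.Nullary using (¬_; yes; no)

open import Algebra using (CommutativeRing; Op₁; Op₂)
open import Algebra.Structures using (IsCommutativeRing)
open import Algebra.Morphism.Structures using (IsRingHomomorphism)
open import Algebra.Consequences.Propositional
  using (comm∧idˡ⇒id; comm∧invˡ⇒inv; comm∧distrˡ⇒distrʳ)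
open import Algebra.Solver.Ring.AlmostCommutativeRing
  using (fromCommutativeRing; _-Raw-AlmostCommutative⟶_; Induced-equivalence)
open import Data.Integer as ℤ using (ℤ; +_; -[1+_]; sign; ∣_∣)
import Data.Integer.Properties as ℤ
import Data.Nat as ℕ
open import Data.Nat.Properties using (+-suc)
open import Data.Maybe using (just; nothing)
open import Level using (0ℓ)
open import Data.Sign as Sign using (Sign)
open import Relation.Binary.Definitions using (WeaklyDecidable)
import Relation.Binary.Reasoning.Setoid as SetoidReasoning

-- The ring solver works with integer coefficients, so it reaches an arbitrary commutative ring
-- through fromℤ. The optimised multiples (1 × x = x) make fromℤ 0ℤ and fromℤ 1ℤ reduce to 0#
-- and 1#, so that con 0ℤ and con 1ℤ in a solver equation denote the ring's own constants.
module IntegerCoefficients {a ℓ} (R : CommutativeRing a ℓ) where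

  open CommutativeRing R renaming (refl to ≈-refl)
  open import Algebra.Properties.Ring ring using (-‿distribˡ-*; -‿distribʳ-*)
  open import Algebra.Properties.AbelianGroup +-abelianGroup
    using (ε⁻¹≈ε; ⁻¹-involutive; ⁻¹-∙-comm; xyx⁻¹≈y)
  open import Algebra.Properties.Semiring.Mult.TCOptimised semiring using (1+×; ×-homo-+; ×1-homo-*)
    renaming (_×_ to _×ᵣ_)
  open SetoidReasoning setoid

  signed : Sign → Carrier → Carrier
  signed Sign.+ x = x
  signed Sign.- x = - x

  fromℤ : ℤ → Carrier
  fromℤ i = signed (sign i) (∣ i ∣ ×ᵣ 1#)

  signed-cong : ∀ s {x y} → x ≈ y → signed s x ≈ signed s y
  signed-cong Sign.+ x≈y = x≈y
  signed-cong Sign.- x≈y = -‿cong x≈y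

  signed-* : ∀ s t x y → signed (s Sign.* t) (x * y) ≈ signed s x * signed t y
  signed-* Sign.+ Sign.+ x y = ≈-refl
  signed-* Sign.+ Sign.- x y = -‿distribʳ-* x y
  signed-* Sign.- Sign.+ x y = -‿distribˡ-* x y
  signed-* Sign.- Sign.- x y = begin
    x * y         ≈⟨ ⁻¹-involutive (x * y) ⟨
    - - (x * y)   ≈⟨ -‿cong (-‿distribʳ-* x y) ⟩
    - (x * - y)   ≈⟨ -‿distribˡ-* x (- y) ⟩
    - x * - y     ∎

  fromℤ-◃ : ∀ s n → fromℤ (s ℤ.◃ n) ≈ signed s (n ×ᵣ 1#)
  fromℤ-◃ Sign.+ zero    = ≈-refl
  fromℤ-◃ Sign.- zero    = sym ε⁻¹≈ε
  fromℤ-◃ Sign.+ (suc n) = ≈-refl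
  fromℤ-◃ Sign.- (suc n) = ≈-refl

  fromℤ-⊖ : ∀ m n → fromℤ (m ℤ.⊖ n) ≈ m ×ᵣ 1# - n ×ᵣ 1#
  fromℤ-⊖ m       zero    = sym (trans (+-congˡ ε⁻¹≈ε) (+-identityʳ (m ×ᵣ 1#)))
  fromℤ-⊖ zero    (suc n) = sym (+-identityˡ _)
  fromℤ-⊖ (suc m) (suc n) = begin
    fromℤ (suc m ℤ.⊖ suc n)             ≡⟨ cong fromℤ (ℤ.[1+m]⊖[1+n]≡m⊖n m n) ⟩
    fromℤ (m ℤ.⊖ n)                     ≈⟨ fromℤ-⊖ m n ⟩
    m ×ᵣ 1# - n ×ᵣ 1#                   ≈⟨ +-congʳ (xyx⁻¹≈y 1# (m ×ᵣ 1#)) ⟨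
    1# + m ×ᵣ 1# - 1# - n ×ᵣ 1#         ≈⟨ +-assoc _ (- 1#) (- (n ×ᵣ 1#)) ⟩
    1# + m ×ᵣ 1# + (- 1# - n ×ᵣ 1#)     ≈⟨ +-congˡ (⁻¹-∙-comm 1# (n ×ᵣ 1#)) ⟩
    1# + m ×ᵣ 1# - (1# + n ×ᵣ 1#)       ≈⟨ +-cong (1+× m 1#) (-‿cong (1+× n 1#)) ⟨
    suc m ×ᵣ 1# - suc n ×ᵣ 1#           ∎

  fromℤ-+ : ∀ i j → fromℤ (i ℤ.+ j) ≈ fromℤ i + fromℤ j
  fromℤ-+ (+ m)    (+ n)    = ×-homo-+ 1# m n
  fromℤ-+ (+ m)    -[1+ n ] = fromℤ-⊖ m (suc n)
  fromℤ-+ -[1+ m ] (+ n)    = trans (fromℤ-⊖ n (suc m)) (+-comm _ _)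
  fromℤ-+ -[1+ m ] -[1+ n ] = begin
    - (suc (suc (m ℕ.+ n)) ×ᵣ 1#)         ≡⟨ cong (λ k → - (suc k ×ᵣ 1#)) (+-suc m n) ⟨
    - ((suc m ℕ.+ suc n) ×ᵣ 1#)           ≈⟨ -‿cong (×-homo-+ 1# (suc m) (suc n)) ⟩
    - (suc m ×ᵣ 1# + suc n ×ᵣ 1#)         ≈⟨ ⁻¹-∙-comm _ _ ⟨
    - (suc m ×ᵣ 1#) + - (suc n ×ᵣ 1#)     ∎

  fromℤ-* : ∀ i j → fromℤ (i ℤ.* j) ≈ fromℤ i * fromℤ j
  fromℤ-* i j = begin
    fromℤ (sign i Sign.* sign j ℤ.◃ ∣ i ∣ ℕ.* ∣ j ∣)
      ≈⟨ fromℤ-◃ (sign i Sign.* sign j) (∣ i ∣ ℕ.* ∣ j ∣) ⟩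
    signed (sign i Sign.* sign j) ((∣ i ∣ ℕ.* ∣ j ∣) ×ᵣ 1#)
      ≈⟨ signed-cong (sign i Sign.* sign j) (×1-homo-* ∣ i ∣ ∣ j ∣) ⟩
    signed (sign i Sign.* sign j) ((∣ i ∣ ×ᵣ 1#) * (∣ j ∣ ×ᵣ 1#))
      ≈⟨ signed-* (sign i) (sign j) _ _ ⟩
    fromℤ i * fromℤ j
      ∎

  fromℤ-neg : ∀ i → fromℤ (ℤ.- i) ≈ - fromℤ i
  fromℤ-neg -[1+ n ]    = sym (⁻¹-involutive _)
  fromℤ-neg (+ zero)    = sym ε⁻¹≈ε
  fromℤ-neg (+ (suc n)) = ≈-refl

  fromℤ-homomorphism : ℤ.+-*-rawRing -Raw-AlmostCommutative⟶ fromCommutativeRing R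
  fromℤ-homomorphism = record
    { ⟦_⟧    = fromℤ
    ; +-homo = fromℤ-+
    ; *-homo = fromℤ-*
    ; -‿homo = fromℤ-neg
    ; 0-homo = ≈-refl
    ; 1-homo = ≈-refl
    }

  fromℤ-weaklyDecidable : WeaklyDecidable (Induced-equivalence fromℤ-homomorphism)
  fromℤ-weaklyDecidable i j with i ℤ.≟ j
  ... | yes refl = just ≈-refl
  ... | no _     = nothing

module CommutativeRingSolver {a ℓ} (R : CommutativeRing a ℓ) where
  open IntegerCoefficients R using (fromℤ-homomorphism; fromℤ-weaklyDecidable)
  open import Algebra.Solver.Ring
    ℤ.+-*-rawRing (fromCommutativeRing R) fromℤ-homomorphism fromℤ-weaklyDecidable public

-- A × A with these operations is A[√k] = A[X]/(X² − k), the pair (a , b) standing for a + b√k.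
module QuadraticExtension
  {a} {A : Set a} {_+_ _*_ : Op₂ A} { -_ : Op₁ A} {0# 1# : A}
  (base : IsCommutativeRing _≡_ _+_ _*_ -_ 0# 1#) (k : A)
  where

  open IsCommutativeRing base using (+-assoc; +-comm; +-identityˡ; -‿inverseˡ)

  private
    baseRing : CommutativeRing a a
    baseRing = record { isCommutativeRing = base }

  open CommutativeRingSolver baseRing using (solve; _:=_; _:+_; _:*_; :-_; con)

  _+ₖ_ _*ₖ_ : Op₂ (A × A)
  (a , b) +ₖ (c , d) = (a + c) , (b + d)
  (a , b) *ₖ (c , d) = ((a * c) + ((b * d) * k)) , ((a * d) + (b * c))

  -ₖ_ : Op₁ (A × A)
  -ₖ (a , b) = (- a) , (- b)

  0ₖ 1ₖ : A × A
  0ₖ = 0# , 0#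
  1ₖ = 1# , 0#

  embed : A → A × A
  embed a = a , 0#

  +ₖ-assoc : ∀ x y z → (x +ₖ y) +ₖ z ≡ x +ₖ (y +ₖ z)
  +ₖ-assoc (a , b) (c , d) (e , f) = cong₂ _,_ (+-assoc a c e) (+-assoc b d f)

  +ₖ-comm : ∀ x y → x +ₖ y ≡ y +ₖ x
  +ₖ-comm (a , b) (c , d) = cong₂ _,_ (+-comm a c) (+-comm b d)

  +ₖ-identityˡ : ∀ x → 0ₖ +ₖ x ≡ x
  +ₖ-identityˡ (a , b) = cong₂ _,_ (+-identityˡ a) (+-identityˡ b)

  -ₖ-inverseˡ : ∀ x → (-ₖ x) +ₖ x ≡ 0ₖ
  -ₖ-inverseˡ (a , b) = cong₂ _,_ (-‿inverseˡ a) (-‿inverseˡ b)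

  *ₖ-assoc : ∀ x y z → (x *ₖ y) *ₖ z ≡ x *ₖ (y *ₖ z)
  *ₖ-assoc (a , b) (c , d) (e , f) = cong₂ _,_
    (solve 7 (λ a b c d e f k →
        (a :* c :+ b :* d :* k) :* e :+ (a :* d :+ b :* c) :* f :* k
      := a :* (c :* e :+ d :* f :* k) :+ b :* (c :* f :+ d :* e) :* k)
      refl a b c d e f k)
    (solve 7 (λ a b c d e f k →
        (a :* c :+ b :* d :* k) :* f :+ (a :* d :+ b :* c) :* e
      := a :* (c :* f :+ d :* e) :+ b :* (c :* e :+ d :* f :* k))
      refl a b c d e f k)

  *ₖ-comm : ∀ x y → x *ₖ y ≡ y *ₖ x
  *ₖ-comm (a , b) (c , d) = cong₂ _,_
    (solve 5 (λ a b c d k → a :* c :+ b :* d :* k := c :* a :+ d :* b :* k) refl a b c d k)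
    (solve 4 (λ a b c d → a :* d :+ b :* c := c :* b :+ d :* a) refl a b c d)

  *ₖ-identityˡ : ∀ x → 1ₖ *ₖ x ≡ x
  *ₖ-identityˡ (a , b) = cong₂ _,_
    (solve 3 (λ a b k → con ℤ.1ℤ :* a :+ con ℤ.0ℤ :* b :* k := a) refl a b k)
    (solve 2 (λ a b → con ℤ.1ℤ :* b :+ con ℤ.0ℤ :* a := b) refl a b)

  *ₖ-distribˡ-+ₖ : ∀ x y z → x *ₖ (y +ₖ z) ≡ (x *ₖ y) +ₖ (x *ₖ z)
  *ₖ-distribˡ-+ₖ (a , b) (c , d) (e , f) = cong₂ _,_
    (solve 7 (λ a b c d e f k →
        a :* (c :+ e) :+ b :* (d :+ f) :* k := (a :* c :+ b :* d :* k) :+ (a :* e :+ b :* f :* k))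
      refl a b c d e f k)
    (solve 6 (λ a b c d e f →
        a :* (d :+ f) :+ b :* (c :+ e) := (a :* d :+ b :* c) :+ (a :* f :+ b :* e))
      refl a b c d e f)

  isCommutativeRing : IsCommutativeRing _≡_ _+ₖ_ _*ₖ_ -ₖ_ 0ₖ 1ₖ
  isCommutativeRing = record
    { isRing = record
      { +-isAbelianGroup = record
        { isGroup = record
          { isMonoid = record
            { isSemigroup = record
              { isMagma = record { isEquivalence = isEquivalence ; ∙-cong = cong₂ _+ₖ_ }
              ; assoc = +ₖ-assoc
              }
            ; identity = comm∧idˡ⇒id +ₖ-comm +ₖ-identityˡ
            }
          ; inverse = comm∧invˡ⇒inv +ₖ-comm -ₖ-inverseˡ
          ; ⁻¹-cong = cong -ₖ_
          }
        ; comm = +ₖ-comm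
        }
      ; *-cong = cong₂ _*ₖ_
      ; *-assoc = *ₖ-assoc
      ; *-identity = comm∧idˡ⇒id *ₖ-comm *ₖ-identityˡ
      ; distrib = *ₖ-distribˡ-+ₖ , comm∧distrˡ⇒distrʳ *ₖ-comm *ₖ-distribˡ-+ₖ
      }
    ; *-comm = *ₖ-comm
    }

  embed-+ : ∀ x y → embed (x + y) ≡ embed x +ₖ embed y
  embed-+ x y = cong (x + y ,_) (solve 0 (con ℤ.0ℤ := con ℤ.0ℤ :+ con ℤ.0ℤ) refl)

  embed-* : ∀ x y → embed (x * y) ≡ embed x *ₖ embed y
  embed-* x y = cong₂ _,_
    (solve 3 (λ x y k → x :* y := x :* y :+ con ℤ.0ℤ :* con ℤ.0ℤ :* k) refl x y k)
    (solve 2 (λ x y → con ℤ.0ℤ := x :* con ℤ.0ℤ :+ con ℤ.0ℤ :* y) refl x y)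

  embed-neg : ∀ x → embed (- x) ≡ -ₖ embed x
  embed-neg x = cong (- x ,_) (solve 0 (con ℤ.0ℤ := :- con ℤ.0ℤ) refl)

  commutativeRing : CommutativeRing a a
  commutativeRing = record { isCommutativeRing = isCommutativeRing }

  embed-isRingHomomorphism :
    IsRingHomomorphism (CommutativeRing.rawRing baseRing) (CommutativeRing.rawRing commutativeRing) embed
  embed-isRingHomomorphism = record
    { isSemiringHomomorphism = record
      { isNearSemiringHomomorphism = record
        { +-isMonoidHomomorphism = record
          { isMagmaHomomorphism = record
            { isRelHomomorphism = record { cong = cong embed }
            ; homo = embed-+
            }
          ; ε-homo = refl
          }
        ; *-homo = embed-*
        }
      ; 1#-homo = refl
      }
    ; -‿homo = embed-neg
    }

ZX-isCommutativeRing : ∀ m → IsCommutativeRing _≡_ (addX m) (mulX m) (negX m) (zeroX m) (oneX m)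
ZX-isCommutativeRing zero    = ℤ.+-*-isCommutativeRing
ZX-isCommutativeRing (suc m) =
  QuadraticExtension.isCommutativeRing (ZX-isCommutativeRing m) (addX m (twoX m) (genX m))

ZX-commutativeRing : ℕ → CommutativeRing 0ℓ 0ℓ
ZX-commutativeRing m = record { isCommutativeRing = ZX-isCommutativeRing m }

incl-isRingHomomorphism : ∀ m →
  IsRingHomomorphism (CommutativeRing.rawRing (ZX-commutativeRing m))
                     (CommutativeRing.rawRing (ZX-commutativeRing (suc m))) (incl m)
incl-isRingHomomorphism m =
  QuadraticExtension.embed-isRingHomomorphism (ZX-isCommutativeRing m) (addX m (twoX m) (genX m))

module _ {a b ℓ₁ ℓ₂} {R : CommutativeRing a ℓ₁} {S : CommutativeRing b ℓ₂}
  {ι : CommutativeRing.Carrier R → CommutativeRing.Carrier S}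
  (ι-isRingHomomorphism : IsRingHomomorphism (CommutativeRing.rawRing R) (CommutativeRing.rawRing S) ι)
  where

  private
    module R = CommutativeRing R

  open CommutativeRing S renaming (refl to ≈-refl)
  open IsRingHomomorphism ι-isRingHomomorphism using (+-homo; *-homo; -‿homo)
  open CommutativeRingSolver S using (solve; _:=_; _:+_; _:*_; :-_; _:-_)
  open SetoidReasoning setoid

  fixed-point⇒linear-relation : ∀ α {b c s t u v} →
    α * α + ι b * α + ι c ≈ 0# →
    ι s * α + ι t ≈ α * (ι u * α + ι v) →
    ι (v R.- (s R.+ u R.* b)) * α + ι (R.- (u R.* c) R.- t) ≈ 0#
  fixed-point⇒linear-relation α {b} {c} {s} {t} {u} {v} root fixed = begin
    ι (v R.- (s R.+ u R.* b)) * α + ι (R.- (u R.* c) R.- t)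
      ≈⟨ +-cong (*-congʳ ι-leading) ι-constant ⟩
    (ι v - (ι s + ι u * ι b)) * α + (- (ι u * ι c) - ι t)
      ≈⟨ solve 7 (λ α b c s t u v →
           (v :- (s :+ u :* b)) :* α :+ (:- (u :* c) :- t)
           := :- u :* (α :* α :+ b :* α :+ c) :+ (α :* (u :* α :+ v) :- (s :* α :+ t)))
           ≈-refl α (ι b) (ι c) (ι s) (ι t) (ι u) (ι v) ⟩
    - ι u * (α * α + ι b * α + ι c) + (α * (ι u * α + ι v) - (ι s * α + ι t))
      ≈⟨ +-cong (*-congˡ root) (+-congˡ (-‿cong fixed)) ⟩
    - ι u * 0# + (α * (ι u * α + ι v) - α * (ι u * α + ι v))
      ≈⟨ +-cong (zeroʳ (- ι u)) (-‿inverseʳ _) ⟩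
    0# + 0#
      ≈⟨ +-identityʳ 0# ⟩
    0# ∎
    where
    ι-leading : ι (v R.- (s R.+ u R.* b)) ≈ ι v - (ι s + ι u * ι b)
    ι-leading = trans (+-homo v _)
      (+-congˡ (trans (-‿homo _) (-‿cong (trans (+-homo s _) (+-congˡ (*-homo u b))))))

    ι-constant : ι (R.- (u R.* c) R.- t) ≈ - (ι u * ι c) - ι t
    ι-constant = trans (+-homo _ _) (+-cong (trans (-‿homo _) (-‿cong (*-homo u c))) (-‿homo t))

module _ {a ℓ} (R : CommutativeRing a ℓ) where

  open CommutativeRing R renaming (refl to ≈-refl)
  open CommutativeRingSolver R using (solve; _:=_; _:+_; _:*_; _:-_; con)
  open SetoidReasoning setoid

  entries-via-trace : ∀ {b c s t u v} → v ≈ s + u * b → t ≈ - (u * c) →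
    (1# + 1#) * s ≈ (s + v) - b * u × t ≈ - (c * u) × (1# + 1#) * v ≈ (s + v) + b * u
  entries-via-trace {b} {c} {s} {t} {u} {v} v≈s+ub t≈-uc =
    twice-s , trans t≈-uc (-‿cong (*-comm u c)) , twice-v
    where
    twice-s : (1# + 1#) * s ≈ (s + v) - b * u
    twice-s = begin
      (1# + 1#) * s             ≈⟨ solve 3 (λ b s u →
                                     (con ℤ.1ℤ :+ con ℤ.1ℤ) :* s := s :+ (s :+ u :* b) :- b :* u)
                                     ≈-refl b s u ⟩
      s + (s + u * b) - b * u   ≈⟨ +-congʳ (+-congˡ v≈s+ub) ⟨
      s + v - b * u             ∎
    twice-v : (1# + 1#) * v ≈ (s + v) + b * u
    twice-v = begin
      (1# + 1#) * v             ≈⟨ solve 1 (λ v → (con ℤ.1ℤ :+ con ℤ.1ℤ) :* v := v :+ v)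
                                     ≈-refl v ⟩
      v + v                     ≈⟨ +-congʳ v≈s+ub ⟩
      s + u * b + v             ≈⟨ solve 4 (λ b s u v → s :+ u :* b :+ v := s :+ v :+ b :* u)
                                     ≈-refl b s u v ⟩
      s + v + b * u             ∎

lemma2p1 : (m : ℕ) (α : ZX (suc m))
    → ¬ (Σ (ZX m) λ a → incl m a ≡ α)
    → (b c : ZX m) → IsMinPoly m α b c
    → (s t u v : ZX m) → IsGL2 m (mat s t u v) → FixesMob m (mat s t u v) α
    → Σ (ZX m) λ x → Σ (ZX m) λ y →
        (mulX m (twoX m) s ≡ subX m x (mulX m b y))
        × (t ≡ negX m (mulX m c y))
        × (u ≡ y)
        × (mulX m (twoX m) v ≡ addX m x (mulX m b y))
lemma2p1 m α _ b c (root , minimal) s t u v _ (_ , fixed) =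
  let p≡0 , q≡0 = minimal (v - (s + u * b)) (- (u * c) - t)
        (fixed-point⇒linear-relation {R = ZX-commutativeRing m} {S = ZX-commutativeRing (suc m)}
           (incl-isRingHomomorphism m) α root fixed)
      twice-s , t≡-cu , twice-v =
        entries-via-trace (ZX-commutativeRing m)
          (x∙y⁻¹≈ε⇒x≈y _ _ p≡0) (sym (x∙y⁻¹≈ε⇒x≈y _ _ q≡0))
  in  s + v , u , twice-s , t≡-cu , refl , twice-v
  where
  open CommutativeRing (ZX-commutativeRing m) using (_+_; _*_; -_; _-_; sym; +-abelianGroup)
  open import Algebra.Properties.AbelianGroup +-abelianGroup using (x∙y⁻¹≈ε⇒x≈y)
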